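{- Let $\boldsymbol{A}\in\mathsf{PSL}$ be finite. Then $\boldsymbol{A}^+$ is the $\langle\wedge,\neg,0,1\rangle$-reduct of a Heyting algebra, $\boldsymbol{A}^+\in\mathsf{PSL}$, and the map $\epsilon_{\boldsymbol{A}}\colon\boldsymbol{A}\to\boldsymbol{A}^+$ is an embedding.
   Context: $\mathsf{PSL}$ is the class of pseudocomplemented semilattices $\langle A;\wedge,\neg,0,1\rangle$: semilattices with least element $0$ and greatest $1$ in which $\neg a$ is the largest $c$ with $c\wedge a=0$. For a semilattice $\boldsymbol{A}$, an element $a$ is join irreducible if it is not the minimum and for all $b,c$ such that the join $b\vee c$ exists, $a=b\vee c$ implies $a=b$ or $a=c$; $\mathsf{J}(\boldsymbol{A})$ is the subposet of join irreducible elements. For finite $\boldsymbol{A}$, $\boldsymbol{A}^+=\langle\mathsf{Dw}(\mathsf{J}(\boldsymbol{A}));\cap,\neg,\emptyset,\mathsf{J}(\boldsymbol{A})\rangle$, where $\mathsf{Dw}(\mathsf{J}(\boldsymbol{A}))$ is the set of downsets of $\mathsf{J}(\boldsymbol{A})$ and $\neg D=\{a\in\mathsf{J}(\boldsymbol{A}): D\cap{\downarrow}a=\emptyset\}$; and $\epsilon_{\boldsymbol{A}}(a)=\mathsf{J}(\boldsymbol{A})\cap{\downarrow}a$. -}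

module Defs where

open import Level using (Level; _⊔_; 0ℓ)
open import Data.Nat using (ℕ)
open import Data.Fin using (Fin)
open import Data.Product using (Σ; _×_; _,_; proj₁; proj₂)
open import Data.Sum using (_⊎_)
open import Data.Empty using (⊥)
open import Relation.Nullary using (¬_)
open import Relation.Unary using (Pred; _≐_)
open import Relation.Binary.Core using (Rel)
open import Relation.Binary.PropositionalEquality using (_≡_; refl; sym; trans; cong)
open import Algebra.Core using (Op₁; Op₂)
open import Algebra.Definitions using (Congruent₁)
open import Algebra.Lattice.Structures using (IsSemilattice)

module _ {a ℓ} {A : Set a} (_≈_ : Rel A ℓ) (_∧_ : Op₂ A) where

  MeetLeq : Rel A ℓ
  MeetLeq x y = x ≈ (x ∧ y)

record IsPSL {a ℓ} {A : Set a} (_≈_ : Rel A ℓ)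
             (_∧_ : Op₂ A) (¬′_ : Op₁ A) (0# 1# : A) : Set (a ⊔ ℓ) where
  field
    isSemilattice : IsSemilattice _≈_ _∧_
    ¬-cong        : Congruent₁ _≈_ ¬′_
    least         : ∀ x → MeetLeq _≈_ _∧_ 0# x
    greatest      : ∀ x → MeetLeq _≈_ _∧_ x 1#
    ¬-annihilates : ∀ x → ((¬′ x) ∧ x) ≈ 0#
    ¬-largest     : ∀ x c → (c ∧ x) ≈ 0# → MeetLeq _≈_ _∧_ c (¬′ x)

module _ {a ℓ} {A : Set a} (_≈_ : Rel A ℓ) (_∧_ : Op₂ A) where

  private
    _≤_ = MeetLeq _≈_ _∧_

  IsJoinOf : A → A → A → Set (a ⊔ ℓ)
  IsJoinOf b c u = b ≤ u × c ≤ u × (∀ d → b ≤ d → c ≤ d → u ≤ d)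

  IsJoinIrreducible : A → A → Set (a ⊔ ℓ)
  IsJoinIrreducible 0# x =
    ¬ (x ≈ 0#) × (∀ b c → IsJoinOf b c x → (x ≈ b) ⊎ (x ≈ c))

-- Elements of A⁺ are downsets of J(A) (subsets of J(A), given as
-- predicates on Fin n, closed downward within J(A)); equality of
-- elements of A⁺ is equality of the underlying sets.

module Plus {n : ℕ} {_∧_ : Op₂ (Fin n)} {¬′_ : Op₁ (Fin n)} {0# 1# : Fin n}
            (psl : IsPSL _≡_ _∧_ ¬′_ 0# 1#) where

  open IsPSL psl
  open IsSemilattice _≡_ isSemilattice using (assoc)

  _≤_ : Rel (Fin n) 0ℓ
  _≤_ = MeetLeq _≡_ _∧_

  ≤-trans : ∀ {x y z} → x ≤ y → y ≤ z → x ≤ z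
  ≤-trans {x} {y} {z} p q =
    trans p (trans (cong (x ∧_) q) (trans (sym (assoc x y z)) (cong (_∧ z) (sym p))))

  J : Pred (Fin n) 0ℓ
  J = IsJoinIrreducible _≡_ _∧_ 0#

  IsDownsetOfJ : Pred (Fin n) 0ℓ → Set
  IsDownsetOfJ D = (∀ x → D x → J x) × (∀ x y → D x → J y → y ≤ x → D y)

  Carrier⁺ : Set₁
  Carrier⁺ = Σ (Pred (Fin n) 0ℓ) IsDownsetOfJ

  _≈⁺_ : Rel Carrier⁺ 0ℓ
  D ≈⁺ E = proj₁ D ≐ proj₁ E

  _∩⁺_ : Op₂ Carrier⁺
  (D , Dj , Dd) ∩⁺ (E , Ej , Ed) =
    (λ x → D x × E x) ,
    (λ x p → Dj x (proj₁ p)) ,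
    (λ x y p jy y≤x → Dd x y (proj₁ p) jy y≤x , Ed x y (proj₂ p) jy y≤x)

  ∅⁺ : Carrier⁺
  ∅⁺ = (λ _ → ⊥) , (λ _ ()) , (λ _ _ ())

  J⁺ : Carrier⁺
  J⁺ = J , (λ _ p → p) , (λ _ _ _ jy _ → jy)

  ¬⁺_ : Op₁ Carrier⁺
  ¬⁺ (D , Dj , Dd) =
    (λ x → J x × (∀ y → D y → y ≤ x → ⊥)) ,
    (λ x p → proj₁ p) ,
    (λ x y p jy y≤x → jy , λ z Dz z≤y → proj₂ p z Dz (≤-trans z≤y y≤x))

  ε : Fin n → Carrier⁺
  ε a =
    (λ x → J x × x ≤ a) ,
    (λ x p → proj₁ p) ,
    (λ x y p jy y≤x → jy , ≤-trans y≤x (proj₂ p))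

{-# OPTIONS --safe #-}
module Submission where

-- A⁺ is the algebra of downsets of the poset J(A), which is a Heyting algebra under
-- ∩, ∪ and D ⇨ E = {x ∈ J : every y ∈ J below x that lies in D lies in E}; there
-- D ⇨ ∅ is exactly ¬D, so A⁺ is a PSL as is the reduct of any Heyting algebra.
-- Because A is finite, a minimal element among those not below b, taken below a,
-- is join irreducible; so a ≤ b as soon as ε a ⊆ ε b. This makes ε injective, and
-- it also yields x ∧ a = 0 whenever no join irreducible lies below x and a, which
-- is what ε (¬a) ⊇ ¬ ε a needs.

open import Defs
open import Level using (0ℓ; _⊔_)
open import Data.Nat using (ℕ)
open import Data.Fin using (Fin)
open import Data.Fin.Properties using (_≟_)
open import Data.Product using (Σ; _×_; _,_; proj₁; proj₂)
open import Data.Sum using (_⊎_; inj₁; inj₂; [_,_]) renaming (map to ⊎-map)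
open import Data.Empty using (⊥-elim)
open import Data.List using (List; []; _∷_; allFin)
open import Data.List.Membership.Propositional using (_∈_)
open import Data.List.Membership.Propositional.Properties using (∈-allFin)
open import Data.List.Relation.Unary.Any using (here; there)
open import Relation.Nullary using (¬_; yes; no; contradiction)
open import Relation.Nullary.Decidable using (_×-dec_; ¬?)
open import Relation.Unary using (Pred; _⊆_; _≐_)
open import Relation.Unary.Properties using (≐-refl; ≐-sym; ≐-trans; ⊆-reflexive; ⊆-trans; ⊆-antisym)
open import Relation.Binary.Core using (Rel)
open import Relation.Binary.Bundles using (Preorder; DecPoset)
open import Relation.Binary.Structures using (IsPartialOrder)
open import Relation.Binary.Definitions using (Decidable)
open import Relation.Binary.PropositionalEquality using (_≡_; refl; subst)
import Relation.Binary.Construct.On as On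
import Relation.Binary.Construct.NaturalOrder.Left as LeftNaturalOrder
open import Relation.Binary.Lattice.Definitions using (Exponential)
open import Relation.Binary.Lattice.Structures using (IsHeytingAlgebra)
open import Relation.Binary.Lattice.Bundles using (HeytingAlgebra)
import Relation.Binary.Lattice.Properties.HeytingAlgebra as HeytingAlgebraProperties
import Relation.Binary.Lattice.Properties.MeetSemilattice as MeetSemilatticeProperties
open import Algebra.Core using (Op₁; Op₂)
open import Algebra.Lattice.Structures using (IsSemilattice)

module MinimalElements {a ℓ₁ ℓ₂} (P : Preorder a ℓ₁ ℓ₂)
                       (_≲?_ : Decidable (Preorder._≲_ P)) where

  open Preorder P using (Carrier; _≲_) renaming (refl to ≲-refl; trans to ≲-trans)

  IsMinimal : ∀ {p} → Pred Carrier p → Pred Carrier (a ⊔ p ⊔ ℓ₂)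
  IsMinimal Q m = Q m × (∀ y → Q y → y ≲ m → m ≲ y)

  module _ {p} {Q : Pred Carrier p} (Q? : Relation.Unary.Decidable Q) where

    minimal-below-among : ∀ ys {x} → Q x →
      Σ Carrier λ m → m ≲ x × Q m × (∀ y → y ∈ ys → Q y → y ≲ m → m ≲ y)
    minimal-below-among [] qx = _ , ≲-refl , qx , λ _ ()
    minimal-below-among (y ∷ ys) {x} qx with Q? y ×-dec (y ≲? x)
    ... | yes (qy , y≲x) =
      let m , m≲y , qm , min = minimal-below-among ys qy in
      m , ≲-trans m≲y y≲x , qm , λ { _ (here refl) _ _ → m≲y ; z (there z∈ys) → min z z∈ys }
    ... | no ¬[qy×y≲x] =
      let m , m≲x , qm , min = minimal-below-among ys qx in
      m , m≲x , qm ,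
      λ { _ (here refl) qy y≲m → contradiction (qy , ≲-trans y≲m m≲x) ¬[qy×y≲x]
        ; z (there z∈ys) → min z z∈ys }

    minimal-below : (xs : List Carrier) → (∀ y → y ∈ xs) →
                    ∀ {x} → Q x → Σ Carrier λ m → m ≲ x × IsMinimal Q m
    minimal-below xs complete qx =
      let m , m≲x , qm , min = minimal-below-among xs qx in
      m , m≲x , qm , λ y → min y (complete y)

module FiniteSemilattice {n : ℕ} {_∧_ : Op₂ (Fin n)} {0# : Fin n}
                         (isSemilattice : IsSemilattice _≡_ _∧_)
                         (least : ∀ x → MeetLeq _≡_ _∧_ 0# x) where

  ≤-decPoset : DecPoset 0ℓ 0ℓ 0ℓ
  ≤-decPoset = LeftNaturalOrder.decPoset _≡_ _∧_ isSemilattice _≟_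

  open DecPoset ≤-decPoset public
    using (_≤_; _≤?_; preorder) renaming (refl to ≤-refl; trans to ≤-trans; antisym to ≤-antisym)
  open MinimalElements preorder _≤?_

  x∧y≤x : ∀ x y → (x ∧ y) ≤ x
  x∧y≤x = LeftNaturalOrder.x∙y≤x _≡_ _∧_ isSemilattice

  x∧y≤y : ∀ x y → (x ∧ y) ≤ y
  x∧y≤y = LeftNaturalOrder.x∙y≤y _≡_ _∧_ isSemilattice

  ∧-greatest : ∀ {x y z} → z ≤ x → z ≤ y → z ≤ (x ∧ y)
  ∧-greatest = LeftNaturalOrder.∙-presʳ-≤ _≡_ _∧_ isSemilattice _

  J : Pred (Fin n) 0ℓ
  J = IsJoinIrreducible _≡_ _∧_ 0#

  ≤0#⇒≡0# : ∀ {x} → x ≤ 0# → x ≡ 0#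
  ≤0#⇒≡0# x≤0# = ≤-antisym x≤0# (least _)

  minimal-not-below-isJoinIrreducible : ∀ {b m} → IsMinimal (λ y → ¬ y ≤ b) m → J m
  minimal-not-below-isJoinIrreducible {b} {m} (m≰b , min) = m≢0# , irreducible
    where
    m≢0# : ¬ m ≡ 0#
    m≢0# refl = m≰b (least b)

    irreducible : ∀ c d → IsJoinOf _≡_ _∧_ c d m → m ≡ c ⊎ m ≡ d
    irreducible c d (c≤m , d≤m , lub) with c ≤? b | d ≤? b
    ... | no c≰b  | _       = inj₁ (≤-antisym (min c c≰b c≤m) c≤m)
    ... | yes _   | no d≰b  = inj₂ (≤-antisym (min d d≰b d≤m) d≤m)
    ... | yes c≤b | yes d≤b = contradiction (lub b c≤b d≤b) m≰b

  ≤-by-joinIrreducibles : ∀ {a b} → (∀ x → J x → x ≤ a → x ≤ b) → a ≤ b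
  ≤-by-joinIrreducibles {a} {b} below with a ≤? b
  ... | yes a≤b = a≤b
  ... | no a≰b =
    let m , m≤a , minimal = minimal-below (λ y → ¬? (y ≤? b)) (allFin n) ∈-allFin a≰b
    in contradiction (below m (minimal-not-below-isJoinIrreducible minimal) m≤a) (proj₁ minimal)

module _ {c ℓ₁ ℓ₂} {A : Set c} {_≈_ : Rel A ℓ₁} {_≤_ : Rel A ℓ₂} {_∨_ _∧_ _⇨_ : Op₂ A} {⊤ ⊥ : A}
         (isHeytingAlgebra : IsHeytingAlgebra _≈_ _≤_ _∨_ _∧_ _⇨_ ⊤ ⊥) where

  private
    heytingAlgebra : HeytingAlgebra c ℓ₁ ℓ₂
    heytingAlgebra = record { isHeytingAlgebra = isHeytingAlgebra }

    open HeytingAlgebra heytingAlgebra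
      using (module Eq; antisym; reflexive; maximum; minimum;
             x∧y≤x; ∧-greatest; transpose-⇨; meetSemilattice)
      renaming (refl to ≤-refl; trans to ≤-trans)
    open HeytingAlgebraProperties heytingAlgebra using (⇨-eval; ⇨-cong)
    open MeetSemilatticeProperties meetSemilattice using (isAlgSemilattice; ∧-monotonic)

    ≤⇒meetLeq : ∀ {x y} → x ≤ y → MeetLeq _≈_ _∧_ x y
    ≤⇒meetLeq x≤y = antisym (∧-greatest ≤-refl x≤y) (x∧y≤x _ _)

  isHeytingAlgebra⇒isPSL : {¬′_ : Op₁ A} → (∀ x → (¬′ x) ≈ (x ⇨ ⊥)) → IsPSL _≈_ _∧_ ¬′_ ⊥ ⊤
  isHeytingAlgebra⇒isPSL {¬′_} ¬′≈⇨⊥ = record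
    { isSemilattice = isAlgSemilattice
    ; ¬-cong        = λ {x} {y} x≈y →
                        Eq.trans (¬′≈⇨⊥ x) (Eq.trans (⇨-cong x≈y Eq.refl) (Eq.sym (¬′≈⇨⊥ y)))
    ; least         = λ x → ≤⇒meetLeq (minimum x)
    ; greatest      = λ x → ≤⇒meetLeq (maximum x)
    ; ¬-annihilates = λ x →
                        antisym (≤-trans (∧-monotonic (reflexive (¬′≈⇨⊥ x)) ≤-refl) ⇨-eval) (minimum _)
    ; ¬-largest     = λ x c c∧x≈⊥ →
                        ≤⇒meetLeq (≤-trans (transpose-⇨ (reflexive c∧x≈⊥)) (reflexive (Eq.sym (¬′≈⇨⊥ x))))
    }

module DownsetAlgebra {n : ℕ} {_∧_ : Op₂ (Fin n)} {¬′_ : Op₁ (Fin n)} {0# 1# : Fin n}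
                      (psl : IsPSL _≡_ _∧_ ¬′_ 0# 1#) where

  open IsPSL psl
  open Plus psl using (Carrier⁺; _≈⁺_; _∩⁺_; ∅⁺; J⁺; ¬⁺_; ε)
  open FiniteSemilattice isSemilattice least

  _⊆⁺_ : Rel Carrier⁺ 0ℓ
  D ⊆⁺ E = proj₁ D ⊆ proj₁ E

  ⊆⁺-isPartialOrder : IsPartialOrder _≈⁺_ _⊆⁺_
  ⊆⁺-isPartialOrder = On.isPartialOrder proj₁ ⊆-isPartialOrder
    where
    ⊆-isPartialOrder : IsPartialOrder {A = Pred (Fin n) 0ℓ} _≐_ _⊆_
    ⊆-isPartialOrder = record
      { isPreorder = record
        { isEquivalence = record { refl = ≐-refl ; sym = ≐-sym ; trans = ≐-trans }
        ; reflexive     = ⊆-reflexive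
        ; trans         = ⊆-trans
        }
      ; antisym = ⊆-antisym
      }

  _∪⁺_ : Op₂ Carrier⁺
  (D , D⊆J , D↓) ∪⁺ (E , E⊆J , E↓) =
    (λ x → D x ⊎ E x) ,
    (λ x → [ D⊆J x , E⊆J x ]) ,
    (λ x y x∈D∪E jy y≤x → ⊎-map (λ x∈D → D↓ x y x∈D jy y≤x) (λ x∈E → E↓ x y x∈E jy y≤x) x∈D∪E)

  _⇨⁺_ : Op₂ Carrier⁺
  (D , _ , _) ⇨⁺ (E , _ , _) =
    (λ x → J x × (∀ y → J y → y ≤ x → D y → E y)) ,
    (λ x → proj₁) ,
    (λ x y (_ , D⇒E) jy y≤x → jy , λ z jz z≤y → D⇒E z jz (≤-trans z≤y y≤x))

  ⇨⁺-exponential : Exponential _⊆⁺_ _∩⁺_ _⇨⁺_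
  ⇨⁺-exponential (W , W⊆J , W↓) (X , _ , _) (Y , _ , _) = curry , uncurry
    where
    curry : (λ x → W x × X x) ⊆ Y → W ⊆ (λ x → J x × (∀ y → J y → y ≤ x → X y → Y y))
    curry W∩X⊆Y {x} x∈W = W⊆J x x∈W , λ y jy y≤x y∈X → W∩X⊆Y (W↓ x y x∈W jy y≤x , y∈X)

    uncurry : W ⊆ (λ x → J x × (∀ y → J y → y ≤ x → X y → Y y)) → (λ x → W x × X x) ⊆ Y
    uncurry W⊆X⇨Y {x} (x∈W , x∈X) = let jx , X⇒Y = W⊆X⇨Y x∈W in X⇒Y x jx ≤-refl x∈X

  isHeytingAlgebra⁺ : IsHeytingAlgebra _≈⁺_ _⊆⁺_ _∪⁺_ _∩⁺_ _⇨⁺_ J⁺ ∅⁺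
  isHeytingAlgebra⁺ = record
    { isBoundedLattice = record
      { isLattice = record
        { isPartialOrder = ⊆⁺-isPartialOrder
        ; supremum       = λ _ _ → inj₁ , inj₂ , λ _ D⊆F E⊆F → [ D⊆F , E⊆F ]
        ; infimum        = λ _ _ → proj₁ , proj₂ , λ _ F⊆D F⊆E x∈F → F⊆D x∈F , F⊆E x∈F
        }
      ; maximum = λ (D , D⊆J , _) {x} → D⊆J x
      ; minimum = λ _ ()
      }
    ; exponential = ⇨⁺-exponential
    }

  ⇨⁺∅⁺≈¬⁺ : ∀ X → (X ⇨⁺ ∅⁺) ≈⁺ (¬⁺ X)
  ⇨⁺∅⁺≈¬⁺ (X , X⊆J , _) =
    (λ (jx , X↛∅) → jx , λ y y∈X y≤x → X↛∅ y (X⊆J y y∈X) y≤x y∈X) ,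
    (λ (jx , X∩↓x≡∅) → jx , λ y _ y≤x y∈X → X∩↓x≡∅ y y∈X y≤x)

  isPSL⁺ : IsPSL _≈⁺_ _∩⁺_ ¬⁺_ ∅⁺ J⁺
  isPSL⁺ = isHeytingAlgebra⇒isPSL isHeytingAlgebra⁺ (λ X → ≐-sym (⇨⁺∅⁺≈¬⁺ X))

  ε-∧-homo : ∀ a b → ε (a ∧ b) ≈⁺ (ε a ∩⁺ ε b)
  ε-∧-homo a b =
    (λ (jx , x≤a∧b) → (jx , ≤-trans x≤a∧b (x∧y≤x a b)) , (jx , ≤-trans x≤a∧b (x∧y≤y a b))) ,
    (λ ((jx , x≤a) , (_ , x≤b)) → jx , ∧-greatest x≤a x≤b)

  ≤¬′-disjoint : ∀ {a y} → y ≤ (¬′ a) → y ≤ a → y ≡ 0#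
  ≤¬′-disjoint {a} y≤¬′a y≤a = ≤0#⇒≡0# (subst (_ ≤_) (¬-annihilates a) (∧-greatest y≤¬′a y≤a))

  ε-¬-homo : ∀ a → ε (¬′ a) ≈⁺ (¬⁺ ε a)
  ε-¬-homo a =
    (λ (jx , x≤¬′a) → jx , λ y (jy , y≤a) y≤x → proj₁ jy (≤¬′-disjoint (≤-trans y≤x x≤¬′a) y≤a)) ,
    (λ {x} x∈¬⁺εa → proj₁ x∈¬⁺εa , ¬-largest a x (x∧a≡0# x∈¬⁺εa))
    where
    x∧a≡0# : ∀ {x} → proj₁ (¬⁺ ε a) x → (x ∧ a) ≡ 0#
    x∧a≡0# {x} (_ , εa∩↓x≡∅) = ≤0#⇒≡0# (≤-by-joinIrreducibles λ y jy y≤x∧a →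
      ⊥-elim (εa∩↓x≡∅ y (jy , ≤-trans y≤x∧a (x∧y≤y x a)) (≤-trans y≤x∧a (x∧y≤x x a))))

  ε-0#-homo : ε 0# ≈⁺ ∅⁺
  ε-0#-homo = (λ (jx , x≤0#) → proj₁ jx (≤0#⇒≡0# x≤0#)) , λ ()

  ε-1#-homo : ε 1# ≈⁺ J⁺
  ε-1#-homo = proj₁ , λ {x} jx → jx , greatest x

  ε-reflects-≤ : ∀ {a b} → ε a ⊆⁺ ε b → a ≤ b
  ε-reflects-≤ εa⊆εb = ≤-by-joinIrreducibles λ x jx x≤a → proj₂ (εa⊆εb (jx , x≤a))

  ε-injective : ∀ a b → ε a ≈⁺ ε b → a ≡ b
  ε-injective a b (εa⊆εb , εb⊆εa) = ≤-antisym (ε-reflects-≤ εa⊆εb) (ε-reflects-≤ εb⊆εa)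

lemma5p8 : (n : ℕ) (_∧_ : Op₂ (Fin n)) (¬′_ : Op₁ (Fin n)) (0# 1# : Fin n)
           (psl : IsPSL _≡_ _∧_ ¬′_ 0# 1#) →
           let open Plus psl in
           -- A⁺ is the ⟨∧,¬,0,1⟩-reduct of a Heyting algebra
           (Σ (Rel Carrier⁺ 0ℓ) λ _≤⁺_ → Σ (Op₂ Carrier⁺) λ _∨⁺_ → Σ (Op₂ Carrier⁺) λ _⇨⁺_ →
              IsHeytingAlgebra _≈⁺_ _≤⁺_ _∨⁺_ _∩⁺_ _⇨⁺_ J⁺ ∅⁺
              × (∀ x → (x ⇨⁺ ∅⁺) ≈⁺ (¬⁺ x)))
           -- A⁺ ∈ PSL
           × IsPSL _≈⁺_ _∩⁺_ ¬⁺_ ∅⁺ J⁺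
           -- ε is an embedding (injective ⟨∧,¬,0,1⟩-homomorphism)
           × (∀ a b → ε (a ∧ b) ≈⁺ (ε a ∩⁺ ε b))
           × (∀ a → ε (¬′ a) ≈⁺ (¬⁺ ε a))
           × (ε 0# ≈⁺ ∅⁺)
           × (ε 1# ≈⁺ J⁺)
           × (∀ a b → ε a ≈⁺ ε b → a ≡ b)
lemma5p8 n _∧_ ¬′_ 0# 1# psl =
  (_⊆⁺_ , _∪⁺_ , _⇨⁺_ , isHeytingAlgebra⁺ , ⇨⁺∅⁺≈¬⁺) , isPSL⁺ ,
  ε-∧-homo , ε-¬-homo , ε-0#-homo , ε-1#-homo , ε-injective
  where open DownsetAlgebra psl
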